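{- Let $H=(V,\mathcal F)$ be a hypergraph with $\mathcal F\neq\emptyset$ and $k$ an integer, such that none of the following reduction rules applies to $(H,k)$: (Rule 1) there exist distinct edges $e,e'\in\mathcal F$ with $e\subseteq e'$; (Rule 2) there exist distinct vertices $u,v\in V$ with $\mathcal F[u]\subseteq\mathcal F[v]$; (Rule 3) there exist $v\in V$ and $e\in\mathcal F$ with $\mathcal F[v]=\{e\}$ and $e=\{v\}$. Let $S^*$ be the set produced by the following greedy procedure: start with $S^*=\emptyset$; while $|\mathcal F[S^*]|<|S^*|+k$ and there is $v\in V$ with $|\mathcal F[v]\setminus\mathcal F[S^*]|>1$, pick a vertex $v\in V$ maximizing $|\mathcal F[v]\setminus\mathcal F[S^*]|$ and add it to $S^*$. Let $\mathcal C=\mathcal F[S^*]$ and $\mathcal I=\mathcal F\setminus\mathcal C$. Suppose $S^*$ is not a mini-hitting set. Then: (1) $|S^*|<k$; (2) $|\mathcal C|<2k$; (3) for every $v\in V$, $|\mathcal C[v]|\ge 1$ and $|\mathcal I[v]|\le 1$; (4) for every $v\in V$, $d(v)\le k$.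
   Context: A hypergraph $H=(V,\mathcal F)$ consists of a nonempty vertex set $V$ and a family $\mathcal F$ of nonempty subsets of $V$ (edges), parallel edges allowed. For $v\in V$ and $\mathcal E\subseteq\mathcal F$, $\mathcal E[v]$ is the set of edges of $\mathcal E$ containing $v$; $d(v)=|\mathcal F[v]|$; for $T\subseteq V$, $\mathcal F[T]=\bigcup_{v\in T}\mathcal F[v]$. A mini-hitting set (with respect to $k$) is a set $S\subseteq V$ with $|S|\le k$ and $|\mathcal F[S]|\ge |S|+k$. -}

module Defs where

open import Data.Nat using (ℕ; suc; _+_; _*_; _<_; _≤_)
open import Data.Bool using (if_then_else_)
open import Data.Fin using (Fin)
open import Data.Fin.Subset
  using (Subset; _∈_; _⊆_; _∪_; _∩_; _─_; ∁; ⋃; ∣_∣; ⁅_⁆; Nonempty)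
  renaming (⊥ to ∅)
open import Data.List using (List; map; allFin)
open import Data.Vec using (lookup; tabulate)
open import Data.Product using (Σ; ∃; _×_)
open import Relation.Binary.PropositionalEquality using (_≡_; _≢_)
open import Relation.Nullary using (¬_)

-- A hypergraph with vertex set Fin n and m edges (parallel edges allowed,
-- edges indexed by Fin m); each edge is a subset of the vertices.
record Hypergraph : Set where
  field
    n m   : ℕ
    edge  : Fin m → Subset n
    edge-nonempty : (i : Fin m) → Nonempty (edge i)

open Hypergraph public

module _ (H : Hypergraph) where

  F[_] : Fin (n H) → Subset (m H)
  F[ v ] = tabulate (λ i → lookup (edge H i) v)

  F⟦_⟧ : Subset (n H) → Subset (m H)
  F⟦ T ⟧ = ⋃ (map (λ v → if lookup T v then F[ v ] else ∅) (allFin (n H)))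

  deg : Fin (n H) → ℕ
  deg v = ∣ F[ v ] ∣

  MiniHitting : ℕ → Subset (n H) → Set
  MiniHitting k S = ∣ S ∣ ≤ k × ∣ S ∣ + k ≤ ∣ F⟦ S ⟧ ∣

  Rule1Applies : Set
  Rule1Applies = Σ (Fin (m H)) λ e → Σ (Fin (m H)) λ e' →
                   e ≢ e' × edge H e ⊆ edge H e'

  Rule2Applies : Set
  Rule2Applies = Σ (Fin (n H)) λ u → Σ (Fin (n H)) λ v →
                   u ≢ v × F[ u ] ⊆ F[ v ]

  Rule3Applies : Set
  Rule3Applies = Σ (Fin (n H)) λ v → Σ (Fin (m H)) λ e →
                   F[ v ] ≡ ⁅ e ⁆ × edge H e ≡ ⁅ v ⁆

  gain : Subset (n H) → Fin (n H) → ℕ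
  gain S v = ∣ F[ v ] ─ F⟦ S ⟧ ∣

  Continue : ℕ → Subset (n H) → Set
  Continue k S = ∣ F⟦ S ⟧ ∣ < ∣ S ∣ + k × ∃ λ v → 1 < gain S v

  -- S is a state reachable by some run of the greedy procedure
  -- (ties in the maximisation broken arbitrarily)
  data GreedyReaches (k : ℕ) : Subset (n H) → Set where
    start : GreedyReaches k ∅
    step  : ∀ {S} (v : Fin (n H)) → GreedyReaches k S → Continue k S →
            ((u : Fin (n H)) → gain S u ≤ gain S v) →
            GreedyReaches k (S ∪ ⁅ v ⁆)

  GreedyOutput : ℕ → Subset (n H) → Set
  GreedyOutput k S = GreedyReaches k S × ¬ Continue k S

module Submission where

-- Adding a vertex v to S covers at least gain S v new edges
-- and increases |S| by at most one.  Since every greedy choice has gain ≥ 2,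
-- every reachable state satisfies the two invariants
--     2|S| ≤ |F[S]|                              (coverage)
--     d(u) + |S| ≤ |F[S]| + max(1, gain S u)     (degree)
-- the second because the first chosen vertex has maximum degree.  Hence the
-- procedure never makes S larger than k.  When S* is not a mini-hitting set
-- we get |C| < |S*| + k, so the loop stopped because every gain is ≤ 1;
-- with the invariants this gives |S*| < k, |C| < 2k and d(u) ≤ k.  Finally
-- irreducibility (Rules 2 and 3, and F ≠ ∅) forces d(v) ≥ 2, so a vertex
-- with at most one edge outside C has at least one edge inside C.

open import Defs
open import Data.Nat using (ℕ; _+_; _*_; _<_; _≤_)
open import Data.Fin using (Fin)
open import Data.Fin.Subset using (Subset; _∩_; ∁; ∣_∣)
open import Data.Product using (_×_)
open import Relation.Nullary using (¬_)

open import Data.Nat using (suc; _⊔_; _≤?_; z≤n; s≤s)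
open import Data.Nat.Properties
  using ( ≤-trans; ≤-<-trans; <-≤-trans; ≰⇒>; ≮⇒≥; <⇒≤; +-comm
        ; +-suc; +-identityʳ; +-mono-≤; +-monoˡ-≤; +-monoʳ-≤
        ; +-cancelʳ-≤; +-cancelˡ-<; m≤n+m; m≤m⊔n; m≤n⊔m; ⊔-lub; m≥n⇒m⊔n≡m
        ; module ≤-Reasoning)
open import Data.Bool using (Bool; true; false; if_then_else_)
open import Data.Fin using (fromℕ<; _≟_)
open import Data.Fin.Subset
  using (_∈_; _⊆_; _∪_; _─_; ⋃; ⁅_⁆; Empty; inside; outside)
  renaming (⊥ to ∅)
open import Data.Fin.Subset.Properties
  using ( nonempty?; ∉⊥; ∣⊥∣≡0; Empty-unique; x∈⁅x⁆; x∈⁅y⁆⇒x≡y; ∣⁅x⁆∣≡1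
        ; ⊆-antisym; p⊆q⇒∣p∣≤∣q∣; p⊆p∪q; q⊆p∪q; x∈p∪q⁻; ∣p─q∣≤∣p∣
        ; p─⊥≡p; x∈p∧x≢y⇒x∈p-y; x∈p⇒∣p-x∣<∣p∣)
open import Data.Vec using ([]; _∷_; lookup; tabulate)
open import Data.Vec.Properties using ([]=⇒lookup; lookup⇒[]=; lookup∘tabulate)
open import Data.List using (List; []; _∷_; map; allFin)
open import Data.List.Relation.Unary.Any using (here; there)
import Data.List.Membership.Propositional as List
open import Data.List.Membership.Propositional.Properties
  using (∈-map⁺; ∈-map⁻; ∈-allFin)
open import Data.Product using (∃; _,_)
open import Data.Sum using (inj₁; inj₂)
open import Relation.Nullary using (yes; no; contradiction)
open import Relation.Binary.PropositionalEquality
  using (_≡_; _≢_; refl; sym; trans; cong; subst)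

p─q≡p∩∁q : ∀ {n} (p q : Subset n) → p ─ q ≡ p ∩ ∁ q
p─q≡p∩∁q []          []          = refl
p─q≡p∩∁q (true  ∷ p) (true  ∷ q) = cong (outside ∷_) (p─q≡p∩∁q p q)
p─q≡p∩∁q (true  ∷ p) (false ∷ q) = cong (inside ∷_) (p─q≡p∩∁q p q)
p─q≡p∩∁q (false ∷ p) (true  ∷ q) = cong (outside ∷_) (p─q≡p∩∁q p q)
p─q≡p∩∁q (false ∷ p) (false ∷ q) = cong (outside ∷_) (p─q≡p∩∁q p q)

∣p∣≡∣p∩q∣+∣p─q∣ : ∀ {n} (p q : Subset n) → ∣ p ∣ ≡ ∣ p ∩ q ∣ + ∣ p ─ q ∣
∣p∣≡∣p∩q∣+∣p─q∣ []          []          = refl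
∣p∣≡∣p∩q∣+∣p─q∣ (true  ∷ p) (true  ∷ q) = cong suc (∣p∣≡∣p∩q∣+∣p─q∣ p q)
∣p∣≡∣p∩q∣+∣p─q∣ (true  ∷ p) (false ∷ q) =
  trans (cong suc (∣p∣≡∣p∩q∣+∣p─q∣ p q)) (sym (+-suc _ _))
∣p∣≡∣p∩q∣+∣p─q∣ (false ∷ p) (true  ∷ q) = ∣p∣≡∣p∩q∣+∣p─q∣ p q
∣p∣≡∣p∩q∣+∣p─q∣ (false ∷ p) (false ∷ q) = ∣p∣≡∣p∩q∣+∣p─q∣ p q

∣p∪q∣≡∣p∣+∣q─p∣ : ∀ {n} (p q : Subset n) → ∣ p ∪ q ∣ ≡ ∣ p ∣ + ∣ q ─ p ∣
∣p∪q∣≡∣p∣+∣q─p∣ []          []          = refl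
∣p∪q∣≡∣p∣+∣q─p∣ (true  ∷ p) (true  ∷ q) = cong suc (∣p∪q∣≡∣p∣+∣q─p∣ p q)
∣p∪q∣≡∣p∣+∣q─p∣ (true  ∷ p) (false ∷ q) = cong suc (∣p∪q∣≡∣p∣+∣q─p∣ p q)
∣p∪q∣≡∣p∣+∣q─p∣ (false ∷ p) (true  ∷ q) =
  trans (cong suc (∣p∪q∣≡∣p∣+∣q─p∣ p q)) (sym (+-suc _ _))
∣p∪q∣≡∣p∣+∣q─p∣ (false ∷ p) (false ∷ q) = ∣p∪q∣≡∣p∣+∣q─p∣ p q

∣p∪⁅x⁆∣≤1+∣p∣ : ∀ {n} (p : Subset n) (x : Fin n) → ∣ p ∪ ⁅ x ⁆ ∣ ≤ suc ∣ p ∣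
∣p∪⁅x⁆∣≤1+∣p∣ p x = begin
  ∣ p ∪ ⁅ x ⁆ ∣          ≡⟨ ∣p∪q∣≡∣p∣+∣q─p∣ p ⁅ x ⁆ ⟩
  ∣ p ∣ + ∣ ⁅ x ⁆ ─ p ∣  ≤⟨ +-monoʳ-≤ ∣ p ∣ (∣p─q∣≤∣p∣ ⁅ x ⁆ p) ⟩
  ∣ p ∣ + ∣ ⁅ x ⁆ ∣      ≡⟨ cong (∣ p ∣ +_) (∣⁅x⁆∣≡1 x) ⟩
  ∣ p ∣ + 1              ≡⟨ +-comm ∣ p ∣ 1 ⟩
  suc ∣ p ∣              ∎
  where open ≤-Reasoning

x∈p⇒1≤∣p∣ : ∀ {n} {x : Fin n} {p : Subset n} → x ∈ p → 1 ≤ ∣ p ∣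
x∈p⇒1≤∣p∣ {x = x} x∈p =
  subst (_≤ _) (∣⁅x⁆∣≡1 x)
        (p⊆q⇒∣p∣≤∣q∣ λ y∈⁅x⁆ → subst (_∈ _) (sym (x∈⁅y⁆⇒x≡y x y∈⁅x⁆)) x∈p)

∣p∣≤1⇒unique : ∀ {n} {x y : Fin n} {p : Subset n} →
               ∣ p ∣ ≤ 1 → x ∈ p → y ∈ p → y ≡ x
∣p∣≤1⇒unique {x = x} {y} {p} ∣p∣≤1 x∈p y∈p with y ≟ x
... | yes y≡x = y≡x
... | no  y≢x = contradiction (≤-trans 2≤∣p∣ ∣p∣≤1) λ { (s≤s ()) }
  where
  -- p ∖ {x} still contains y, and is strictly smaller than p.
  2≤∣p∣ : 2 ≤ ∣ p ∣
  2≤∣p∣ = ≤-trans (s≤s (x∈p⇒1≤∣p∣ (x∈p∧x≢y⇒x∈p-y y∈p y≢x))) (x∈p⇒∣p-x∣<∣p∣ x∈p)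

≡⁅x⁆ : ∀ {n} {x : Fin n} {p : Subset n} →
       x ∈ p → (∀ {y} → y ∈ p → y ≡ x) → p ≡ ⁅ x ⁆
≡⁅x⁆ {x = x} x∈p only-x = ⊆-antisym
  (λ y∈p → subst (_∈ ⁅ x ⁆) (sym (only-x y∈p)) (x∈⁅x⁆ x))
  (λ y∈⁅x⁆ → subst (_∈ _) (sym (x∈⁅y⁆⇒x≡y x y∈⁅x⁆)) x∈p)

meets : ∀ {n} (p q : Subset n) → 2 ≤ ∣ p ∣ → ∣ p ─ q ∣ ≤ 1 → 1 ≤ ∣ p ∩ q ∣
meets p q 2≤∣p∣ ∣p─q∣≤1 = +-cancelʳ-≤ 1 1 ∣ p ∩ q ∣ (begin
  2                        ≤⟨ 2≤∣p∣ ⟩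
  ∣ p ∣                    ≡⟨ ∣p∣≡∣p∩q∣+∣p─q∣ p q ⟩
  ∣ p ∩ q ∣ + ∣ p ─ q ∣    ≤⟨ +-monoʳ-≤ ∣ p ∩ q ∣ ∣p─q∣≤1 ⟩
  ∣ p ∩ q ∣ + 1            ∎)
  where open ≤-Reasoning

∈⋃⁺ : ∀ {n} {x : Fin n} {p : Subset n} (ps : List (Subset n)) →
      p List.∈ ps → x ∈ p → x ∈ ⋃ ps
∈⋃⁺ (q ∷ ps) (here refl) x∈p = p⊆p∪q (⋃ ps) x∈p
∈⋃⁺ (q ∷ ps) (there p∈ps) x∈p = q⊆p∪q q (⋃ ps) (∈⋃⁺ ps p∈ps x∈p)

∈⋃⁻ : ∀ {n} {x : Fin n} (ps : List (Subset n)) →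
      x ∈ ⋃ ps → ∃ λ p → p List.∈ ps × x ∈ p
∈⋃⁻ []       x∈⋃ = contradiction x∈⋃ ∉⊥
∈⋃⁻ (q ∷ ps) x∈⋃ with x∈p∪q⁻ q (⋃ ps) x∈⋃
... | inj₁ x∈q = q , here refl , x∈q
... | inj₂ x∈⋃ps with ∈⋃⁻ ps x∈⋃ps
...   | p , p∈ps , x∈p = p , there p∈ps , x∈p

∈-tabulate⁺ : ∀ {n} {f : Fin n → Bool} {x : Fin n} → f x ≡ inside → x ∈ tabulate f
∈-tabulate⁺ {f = f} {x} fx = lookup⇒[]= x (tabulate f) (trans (lookup∘tabulate f x) fx)

∈-tabulate⁻ : ∀ {n} {f : Fin n → Bool} {x : Fin n} → x ∈ tabulate f → f x ≡ inside
∈-tabulate⁻ {f = f} {x} x∈ = trans (sym (lookup∘tabulate f x)) ([]=⇒lookup x∈)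

half-coverage : ∀ {s c k} → s + s ≤ c → c < s + k → s < k
half-coverage {s} {c} {k} 2s≤c c<s+k = +-cancelˡ-< s s k (≤-<-trans 2s≤c c<s+k)

module _ (H : Hypergraph) where

  incident : Fin (n H) → Subset (m H)
  incident v = F[_] H v

  covered : Subset (n H) → Subset (m H)
  covered T = F⟦_⟧ H T

  edge⇒incident : ∀ {i v} → v ∈ edge H i → i ∈ incident v
  edge⇒incident v∈i = ∈-tabulate⁺ ([]=⇒lookup v∈i)

  incident⇒edge : ∀ {i v} → i ∈ incident v → v ∈ edge H i
  incident⇒edge {i} {v} i∈v = lookup⇒[]= v (edge H i) (∈-tabulate⁻ i∈v)

  incident-if : Subset (n H) → Fin (n H) → Subset (m H)
  incident-if T w = if lookup T w then incident w else ∅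

  covered⁺ : ∀ {i v} T → i ∈ incident v → v ∈ T → i ∈ covered T
  covered⁺ {i} {v} T i∈v v∈T =
    ∈⋃⁺ (map (incident-if T) (allFin (n H))) (∈-map⁺ (incident-if T) (∈-allFin v))
          (subst (λ b → i ∈ (if b then incident v else ∅)) (sym ([]=⇒lookup v∈T)) i∈v)

  covered⁻ : ∀ {i T} → i ∈ covered T → ∃ λ w → w ∈ T × i ∈ incident w
  covered⁻ {i} {T} i∈T with ∈⋃⁻ (map (incident-if T) (allFin (n H))) i∈T
  ... | _ , p∈ , i∈p with ∈-map⁻ (incident-if T) p∈
  ...   | w , _ , refl = select (lookup T w) refl i∈p
    where
    select : ∀ b → lookup T w ≡ b → i ∈ (if b then incident w else ∅) →
             ∃ λ w → w ∈ T × i ∈ incident w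
    select true  w∈T i∈w = w , lookup⇒[]= w T w∈T , i∈w
    select false _   i∈∅ = contradiction i∈∅ ∉⊥

  gain-∅ : ∀ u → gain H ∅ u ≡ deg H u
  gain-∅ u =
    cong ∣_∣ (trans (cong (incident u ─_) covered-∅) (p─⊥≡p (incident u)))
    where
    covered-∅ : covered ∅ ≡ ∅
    covered-∅ = Empty-unique λ { (_ , i∈) → let (_ , w∈∅ , _) = covered⁻ i∈ in ∉⊥ w∈∅ }

  coverage-grows : ∀ S v → ∣ covered S ∣ + gain H S v ≤ ∣ covered (S ∪ ⁅ v ⁆) ∣
  coverage-grows S v = begin
    ∣ covered S ∣ + gain H S v          ≡⟨ ∣p∪q∣≡∣p∣+∣q─p∣ (covered S) (incident v) ⟨
    ∣ covered S ∪ incident v ∣          ≤⟨ p⊆q⇒∣p∣≤∣q∣ covered-∪ ⟩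
    ∣ covered (S ∪ ⁅ v ⁆) ∣             ∎
    where
    open ≤-Reasoning
    covered-∪ : covered S ∪ incident v ⊆ covered (S ∪ ⁅ v ⁆)
    covered-∪ i∈ with x∈p∪q⁻ (covered S) (incident v) i∈
    ... | inj₁ i∈S with covered⁻ i∈S
    ...   | w , w∈S , i∈w = covered⁺ (S ∪ ⁅ v ⁆) i∈w (p⊆p∪q ⁅ v ⁆ w∈S)
    covered-∪ i∈ | inj₂ i∈v = covered⁺ (S ∪ ⁅ v ⁆) i∈v (q⊆p∪q S ⁅ v ⁆ (x∈⁅x⁆ v))

  module _ {k : ℕ} where

    chosen-gain≥2 : ∀ S v → Continue H k S →
                    (∀ u → gain H S u ≤ gain H S v) → 2 ≤ gain H S v
    chosen-gain≥2 _ _ (_ , u , 1<gain-u) maximal = ≤-trans 1<gain-u (maximal u)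

    greedy-coverage : ∀ {S} → GreedyReaches H k S → ∣ S ∣ + ∣ S ∣ ≤ ∣ covered S ∣
    greedy-coverage start = subst (λ s → s + s ≤ ∣ covered ∅ ∣) (sym (∣⊥∣≡0 (n H))) z≤n
    greedy-coverage (step {S} v reached running maximal) = begin
      ∣ S ∪ ⁅ v ⁆ ∣ + ∣ S ∪ ⁅ v ⁆ ∣
        ≤⟨ +-mono-≤ (∣p∪⁅x⁆∣≤1+∣p∣ S v) (∣p∪⁅x⁆∣≤1+∣p∣ S v) ⟩
      suc ∣ S ∣ + suc ∣ S ∣             ≡⟨ cong suc (+-suc ∣ S ∣ ∣ S ∣) ⟩
      2 + (∣ S ∣ + ∣ S ∣)               ≡⟨ +-comm 2 (∣ S ∣ + ∣ S ∣) ⟩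
      (∣ S ∣ + ∣ S ∣) + 2
        ≤⟨ +-mono-≤ (greedy-coverage reached) (chosen-gain≥2 S v running maximal) ⟩
      ∣ covered S ∣ + gain H S v        ≤⟨ coverage-grows S v ⟩
      ∣ covered (S ∪ ⁅ v ⁆) ∣           ∎
      where open ≤-Reasoning

    -- Degree invariant.  Initially the gain of u is its degree; afterwards
    -- every step adds one vertex, and at least max(1, gain S u) new edges
    -- because the chosen gain is ≥ 2 and maximal.
    greedy-degree : ∀ {S} → GreedyReaches H k S →
                    ∀ u → deg H u + ∣ S ∣ ≤ ∣ covered S ∣ + (1 ⊔ gain H S u)
    greedy-degree start u = begin
      deg H u + ∣ ∅ {n H} ∣             ≡⟨ cong (deg H u +_) (∣⊥∣≡0 (n H)) ⟩
      deg H u + 0                       ≡⟨ +-identityʳ (deg H u) ⟩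
      deg H u                           ≡⟨ gain-∅ u ⟨
      gain H ∅ u                        ≤⟨ m≤n⊔m 1 (gain H ∅ u) ⟩
      1 ⊔ gain H ∅ u                    ≤⟨ m≤n+m (1 ⊔ gain H ∅ u) ∣ covered ∅ ∣ ⟩
      ∣ covered ∅ ∣ + (1 ⊔ gain H ∅ u)  ∎
      where open ≤-Reasoning
    greedy-degree (step {S} v reached running maximal) u = begin
      deg H u + ∣ S ∪ ⁅ v ⁆ ∣           ≤⟨ +-monoʳ-≤ (deg H u) (∣p∪⁅x⁆∣≤1+∣p∣ S v) ⟩
      deg H u + suc ∣ S ∣               ≡⟨ +-suc (deg H u) ∣ S ∣ ⟩
      suc (deg H u + ∣ S ∣)             ≤⟨ s≤s (greedy-degree reached u) ⟩
      suc (∣ covered S ∣ + (1 ⊔ gain H S u))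
        ≤⟨ s≤s (+-monoʳ-≤ ∣ covered S ∣ (⊔-lub 1≤gain-v (maximal u))) ⟩
      suc (∣ covered S ∣ + gain H S v)  ≤⟨ s≤s (coverage-grows S v) ⟩
      suc ∣ covered S′ ∣                ≡⟨ +-comm 1 ∣ covered S′ ∣ ⟩
      ∣ covered S′ ∣ + 1                ≤⟨ +-monoʳ-≤ ∣ covered S′ ∣ (m≤m⊔n 1 (gain H S′ u)) ⟩
      ∣ covered S′ ∣ + (1 ⊔ gain H S′ u) ∎
      where
      open ≤-Reasoning
      S′ = S ∪ ⁅ v ⁆
      1≤gain-v : 1 ≤ gain H S v
      1≤gain-v = ≤-trans (s≤s (z≤n {1})) (chosen-gain≥2 S v running maximal)

    -- The loop only runs while |F[S]| < |S| + k, so S never exceeds k vertices.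
    greedy-size : ∀ {S} → GreedyReaches H k S → ∣ S ∣ ≤ k
    greedy-size start = subst (_≤ k) (sym (∣⊥∣≡0 (n H))) z≤n
    greedy-size (step {S} v reached (under , _) _) =
      ≤-trans (∣p∪⁅x⁆∣≤1+∣p∣ S v) (half-coverage (greedy-coverage reached) under)

    stopped-gain≤1 : ∀ S → ¬ Continue H k S → ∣ covered S ∣ < ∣ S ∣ + k →
                     ∀ u → gain H S u ≤ 1
    stopped-gain≤1 _ stopped under u = ≮⇒≥ λ 1<gain-u → stopped (under , u , 1<gain-u)

    stopped-degree : ∀ {S} → GreedyReaches H k S → ∣ covered S ∣ < ∣ S ∣ + k →
                     (∀ u → gain H S u ≤ 1) → ∀ u → deg H u ≤ k
    stopped-degree {S} reached under gain≤1 u = +-cancelʳ-≤ ∣ S ∣ (deg H u) k (begin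
      deg H u + ∣ S ∣                    ≤⟨ greedy-degree reached u ⟩
      ∣ covered S ∣ + (1 ⊔ gain H S u)   ≡⟨ cong (∣ covered S ∣ +_) (m≥n⇒m⊔n≡m (gain≤1 u)) ⟩
      ∣ covered S ∣ + 1                  ≡⟨ +-comm ∣ covered S ∣ 1 ⟩
      suc ∣ covered S ∣                  ≤⟨ under ⟩
      ∣ S ∣ + k                          ≡⟨ +-comm ∣ S ∣ k ⟩
      k + ∣ S ∣                          ∎)
      where open ≤-Reasoning

  -- A vertex in no edge has F[v] ⊆ F[u] for any vertex u of some edge.
  isolated⇒rule2 : ∀ {v} → 1 ≤ m H → Empty (incident v) → Rule2Applies H
  isolated⇒rule2 {v} 1≤m isolated with edge-nonempty H (fromℕ< 1≤m)
  ... | u , u∈e = v , u , v≢u , λ i∈v → contradiction (_ , i∈v) isolated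
    where
    v≢u : v ≢ u
    v≢u refl = isolated (_ , edge⇒incident u∈e)

  -- A vertex with exactly one edge e: unless F[v] ⊆ F[w] for another vertex
  -- w of e (Rule 2), e = {v} and F[v] = {e} (Rule 3).
  leaf⇒rule3 : ∀ {v e} → ¬ Rule2Applies H → e ∈ incident v → deg H v ≤ 1 →
               Rule3Applies H
  leaf⇒rule3 {v} {e} no-rule2 e∈v deg≤1 =
    v , e , ≡⁅x⁆ e∈v only-e , ≡⁅x⁆ (incident⇒edge e∈v) only-v
    where
    only-e : ∀ {e′} → e′ ∈ incident v → e′ ≡ e
    only-e = ∣p∣≤1⇒unique deg≤1 e∈v

    only-v : ∀ {w} → w ∈ edge H e → w ≡ v
    only-v {w} w∈e with w ≟ v
    ... | yes w≡v = w≡v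
    ... | no  w≢v =
      contradiction (v , w , (λ v≡w → w≢v (sym v≡w)) , λ {_} → F[v]⊆F[w]) no-rule2
      where
      F[v]⊆F[w] : incident v ⊆ incident w
      F[v]⊆F[w] e′∈v = subst (_∈ incident w) (sym (only-e e′∈v)) (edge⇒incident w∈e)

  irreducible⇒deg≥2 : 1 ≤ m H → ¬ Rule2Applies H → ¬ Rule3Applies H →
                      ∀ v → 2 ≤ deg H v
  irreducible⇒deg≥2 1≤m no-rule2 no-rule3 v with nonempty? (incident v)
  ... | no  isolated = contradiction (isolated⇒rule2 1≤m isolated) no-rule2
  ... | yes (e , e∈v) with deg H v ≤? 1
  ...   | yes deg≤1 = contradiction (leaf⇒rule3 no-rule2 e∈v deg≤1) no-rule3
  ...   | no  deg≰1 = ≰⇒> deg≰1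

lemma4 : (H : Hypergraph) (k : ℕ) → 1 ≤ n H → 1 ≤ m H →
         ¬ Rule1Applies H → ¬ Rule2Applies H → ¬ Rule3Applies H →
         (S : Subset (n H)) → GreedyOutput H k S → ¬ MiniHitting H k S →
         (∣ S ∣ < k)
         × (∣ F⟦_⟧ H S ∣ < 2 * k)
         × ((v : Fin (n H)) → 1 ≤ ∣ F[_] H v ∩ F⟦_⟧ H S ∣
                            × ∣ F[_] H v ∩ ∁ (F⟦_⟧ H S) ∣ ≤ 1)
         × ((v : Fin (n H)) → deg H v ≤ k)
lemma4 H k _ 1≤m _ no-rule2 no-rule3 S (reached , stopped) not-mini =
  ∣S∣<k , ∣C∣<2k , (λ v → meets-C v , outside-C v) , stopped-degree H reached under gain≤1
  where
  -- S* has at most k vertices, so it fails to be mini-hitting by covering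
  -- too few edges.
  under : ∣ covered H S ∣ < ∣ S ∣ + k
  under = ≰⇒> λ enough → not-mini (greedy-size H reached , enough)

  gain≤1 : ∀ u → gain H S u ≤ 1
  gain≤1 = stopped-gain≤1 H S stopped under

  ∣S∣<k : ∣ S ∣ < k
  ∣S∣<k = half-coverage (greedy-coverage H reached) under

  ∣C∣<2k : ∣ covered H S ∣ < 2 * k
  ∣C∣<2k = <-≤-trans under (subst (∣ S ∣ + k ≤_) (cong (k +_) (sym (+-identityʳ k)))
                                  (+-monoˡ-≤ k (<⇒≤ ∣S∣<k)))

  outside-C : ∀ v → ∣ incident H v ∩ ∁ (covered H S) ∣ ≤ 1
  outside-C v = subst (λ p → ∣ p ∣ ≤ 1) (p─q≡p∩∁q (incident H v) (covered H S)) (gain≤1 v)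

  meets-C : ∀ v → 1 ≤ ∣ incident H v ∩ covered H S ∣
  meets-C v = meets (incident H v) (covered H S)
                    (irreducible⇒deg≥2 H 1≤m no-rule2 no-rule3 v) (gain≤1 v)
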